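{- Let $1\le m\le n$ be integers and let $a_1,a_2,\dots,a_n$ be non-negative integers with $\sum_{i=1}^n a_i=n$. Then \[\sum_{j=1}^{n-m+1} a_j a_{j+1}\cdots a_{j+m-1}\le \left(\frac{n}{m}\right)^m.\] -}

module Defs where

open import Data.Nat using (ℕ; zero; suc; _∸_)
open import Data.Nat.ListAction using (sum; product)
open import Data.List using (List; take; drop; map; upTo; length)
open import Data.Rational using (ℚ; 1ℚ; _*_)

-- For a sequence as = (a₁, …, aₙ) (a list of length n) and a block length m,
-- windowSum m as = Σ_{j=1}^{n-m+1} a_j a_{j+1} ⋯ a_{j+m-1}.
-- (0-indexed: j ranges over 0 … n-m, and the j-th window is take m (drop j as).)
windowSum : ℕ → List ℕ → ℕ
windowSum m as = sum (map (λ j → product (take m (drop j as))) (upTo (suc (length as ∸ m))))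

_^ℚ_ : ℚ → ℕ → ℚ
q ^ℚ zero  = 1ℚ
q ^ℚ suc k = q * (q ^ℚ k)

module Submission where

-- Let m = p + 1 and split the positions of a = (a₀, …, a_{n-1}) into the
-- m residue classes modulo m, with class sums c₀, …, c_p.  Every window
-- a_j ⋯ a_{j+p} contains exactly one entry of each class, and distinct
-- windows are distinct monomials of the expanded product c₀ ⋯ c_p, hence
--     Σ_j a_j ⋯ a_{j+p}  ≤  c₀ ⋯ c_p  ≤  ((c₀ + ⋯ + c_p) / m)^m = (Σ a / m)^m
-- by the AM-GM inequality.

open import Data.Nat hiding (_/_)
open import Data.Nat.Properties
open import Data.Nat.ListAction using (sum; product)
open import Data.Nat.ListAction.Properties using (sum-++; product-++)
open import Data.Nat.Solver using (module +-*-Solver)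
open import Data.List using (List; []; _∷_; _∷ʳ_; take; drop; applyUpTo; length)
open import Data.List.Properties using (map-applyUpTo; applyUpTo-∷ʳ; length-applyUpTo)
open import Data.Sum using (inj₁; inj₂)
open import Relation.Binary.PropositionalEquality
open import Algebra.Bundles using (Ring)
open import Data.Integer using (+_; +≤+) renaming (_*_ to _*ℤ_; _≤_ to _≤ℤ_)
import Data.Integer.Properties as ℤ
open import Data.Rational using (_/_; toℚᵘ) renaming (_≤_ to _≤ℚ_)
import Data.Rational.Properties as ℚ
open import Data.Rational.Unnormalised using (mkℚᵘ; ↥_; ↧ₙ_; *≤*)
  renaming (_*_ to _*ᵘ_; _≃_ to _≃ᵘ_; _≤_ to _≤ᵘ_)
import Data.Rational.Unnormalised.Properties as ℚᵘ
open import Algebra.Properties.Semiring.Exp (Ring.semiring ℚᵘ.+-*-ring)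
  using () renaming (_^_ to _^ᵘ_; ^-congˡ to ^ᵘ-congˡ)
open import Defs

open +-*-Solver

^-distribʳ-* : ∀ a b n → (a * b) ^ n ≡ a ^ n * b ^ n
^-distribʳ-* a b zero    = refl
^-distribʳ-* a b (suc n) = begin
  a * b * (a * b) ^ n       ≡⟨ cong (a * b *_) (^-distribʳ-* a b n) ⟩
  a * b * (a ^ n * b ^ n)   ≡⟨ solve 4 (λ a b A B → a :* b :* (A :* B) := a :* A :* (b :* B)) refl a b (a ^ n) (b ^ n) ⟩
  a * a ^ n * (b * b ^ n)   ∎
  where open ≡-Reasoning

-- kᵏ never vanishes (0⁰ = 1); needed to cancel it in the AM-GM induction.
n^n≢0 : ∀ n → NonZero (n ^ n)
n^n≢0 zero    = _
n^n≢0 (suc n) = m^n≢0 (suc n) (suc n)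

-- Bernoulli's inequality (1 + x)^(n+1) ≥ 1 + (n+1)x for x ≥ 0, homogenised
-- with x = d / c.
bernoulli : ∀ n c d → c ^ n * (c + suc n * d) ≤ (c + d) ^ suc n
bernoulli zero c d = ≤-reflexive (solve 2 (λ c d → con 1 :* (c :+ con 1 :* d) := (c :+ d) :* con 1) refl c d)
bernoulli (suc n) c d = begin
  c ^ suc n * (c + suc (suc n) * d)
    ≤⟨ m≤m+n _ _ ⟩
  c ^ suc n * (c + suc (suc n) * d) + c ^ n * suc n * d * d
    ≡⟨ solve 4 (λ c d C n → c :* C :* (c :+ (con 2 :+ n) :* d) :+ C :* (con 1 :+ n) :* d :* d
                       := (c :+ d) :* (C :* (c :+ (con 1 :+ n) :* d))) refl c d (c ^ n) n ⟩
  (c + d) * (c ^ n * (c + suc n * d))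
    ≤⟨ *-monoʳ-≤ (c + d) (bernoulli n c d) ⟩
  (c + d) ^ suc (suc n)
    ∎
  where open ≤-Reasoning

tangent : ∀ n f e → (f + e) ^ suc n ≤ f ^ suc n + suc n * e * (f + e) ^ n
tangent zero f e = ≤-reflexive (solve 2 (λ f e → (f :+ e) :* con 1 := f :* con 1 :+ con 1 :* e :* con 1) refl f e)
tangent (suc n) f e = begin
  (f + e) * (f + e) ^ suc n
    ≤⟨ *-monoʳ-≤ (f + e) (tangent n f e) ⟩
  (f + e) * (F + suc n * e * G)
    ≡⟨ solve 5 (λ f e F G n → (f :+ e) :* (F :+ (con 1 :+ n) :* e :* G)
                       := f :* F :+ e :* F :+ (con 1 :+ n) :* e :* ((f :+ e) :* G)) refl f e F G n ⟩
  f * F + e * F + suc n * e * ((f + e) * G)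
    ≤⟨ +-monoˡ-≤ _ (+-monoʳ-≤ (f * F) (*-monoʳ-≤ e (^-monoˡ-≤ (suc n) (m≤m+n f e)))) ⟩
  f * F + e * ((f + e) * G) + suc n * e * ((f + e) * G)
    ≡⟨ solve 5 (λ f e F H n → f :* F :+ e :* H :+ (con 1 :+ n) :* e :* H
                       := f :* F :+ (con 2 :+ n) :* e :* H) refl f e F ((f + e) * G) n ⟩
  f ^ suc (suc n) + suc (suc n) * e * (f + e) ^ suc n
    ∎
  where
  open ≤-Reasoning
  F = f ^ suc n
  G = (f + e) ^ n

two-point-core : ∀ k S y → (suc k * S) ^ k * (suc k * (k * y)) ≤ (k * (S + y)) ^ suc k
two-point-core k S y with ≤-total S (k * y)
... | inj₁ S≤ky = begin
  C * (suc k * (k * y))               ≡⟨ cong (λ z → C * (suc k * z)) (m+[n∸m]≡n S≤ky) ⟨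
  C * (suc k * (S + d))               ≡⟨ cong (C *_) (*-distribˡ-+ (suc k) S d) ⟩
  C * (suc k * S + suc k * d)         ≤⟨ bernoulli k (suc k * S) d ⟩
  (suc k * S + d) ^ suc k             ≡⟨ cong (_^ suc k) c+d≡k[S+y] ⟩
  (k * (S + y)) ^ suc k               ∎
  where
  open ≤-Reasoning
  C = (suc k * S) ^ k
  d = k * y ∸ S
  c+d≡k[S+y] : suc k * S + d ≡ k * (S + y)
  c+d≡k[S+y] = begin-equality
    suc k * S + d    ≡⟨ solve 3 (λ k s d → (con 1 :+ k) :* s :+ d := k :* s :+ (s :+ d)) refl k S d ⟩
    k * S + (S + d)  ≡⟨ cong (λ z → k * S + z) (m+[n∸m]≡n S≤ky) ⟩
    k * S + k * y    ≡⟨ *-distribˡ-+ k S y ⟨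
    k * (S + y)      ∎
... | inj₂ ky≤S = +-cancelʳ-≤ (suc k * e * C) _ _ (begin
  C * (suc k * (k * y)) + suc k * e * C
    ≡⟨ solve 4 (λ C k x e → C :* ((con 1 :+ k) :* x) :+ (con 1 :+ k) :* e :* C
                       := (con 1 :+ k) :* (x :+ e) :* C) refl C k (k * y) e ⟩
  suc k * (k * y + e) * C
    ≡⟨ cong (λ z → suc k * z * C) (m+[n∸m]≡n ky≤S) ⟩
  suc k * S * C
    ≡⟨ cong (_^ suc k) f+e≡[k+1]S ⟨
  (f + e) ^ suc k
    ≤⟨ tangent k f e ⟩
  f ^ suc k + suc k * e * (f + e) ^ k
    ≡⟨ cong (λ z → f ^ suc k + suc k * e * z ^ k) f+e≡[k+1]S ⟩
  f ^ suc k + suc k * e * C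
    ∎)
  where
  open ≤-Reasoning
  C = (suc k * S) ^ k
  e = S ∸ k * y
  f = k * (S + y)
  f+e≡[k+1]S : f + e ≡ suc k * S
  f+e≡[k+1]S = begin-equality
    k * (S + y) + e    ≡⟨ solve 4 (λ k s y e → k :* (s :+ y) :+ e := k :* s :+ (k :* y :+ e)) refl k S y e ⟩
    k * S + (k * y + e) ≡⟨ cong (λ z → k * S + z) (m+[n∸m]≡n ky≤S) ⟩
    k * S + S           ≡⟨ +-comm (k * S) S ⟩
    suc k * S           ∎

-- Two-point AM-GM with weights k and 1:  (S/k)^k · y ≤ ((S + y)/(k+1))^(k+1).
two-point-amgm : ∀ k S y → suc k ^ suc k * (S ^ k * y) ≤ k ^ k * (S + y) ^ suc k
two-point-amgm zero    S y = begin
  1 * (1 * y)          ≡⟨ solve 1 (λ y → con 1 :* (con 1 :* y) := y) refl y ⟩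
  y                    ≤⟨ m≤n+m y S ⟩
  S + y                ≡⟨ solve 2 (λ s y → s :+ y := con 1 :* ((s :+ y) :* con 1)) refl S y ⟩
  1 * ((S + y) * 1)    ∎
  where open ≤-Reasoning
two-point-amgm k@(suc _) S y = *-cancelˡ-≤ k (begin
  k * (suc k ^ suc k * (S ^ k * y))
    ≡⟨ solve 4 (λ k K s y → k :* ((con 1 :+ k) :* K :* (s :* y))
                       := K :* s :* ((con 1 :+ k) :* (k :* y))) refl k (suc k ^ k) (S ^ k) y ⟩
  suc k ^ k * S ^ k * (suc k * (k * y))
    ≡⟨ cong (_* (suc k * (k * y))) (^-distribʳ-* (suc k) S k) ⟨
  (suc k * S) ^ k * (suc k * (k * y))
    ≤⟨ two-point-core k S y ⟩
  (k * (S + y)) ^ suc k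
    ≡⟨ ^-distribʳ-* k (S + y) (suc k) ⟩
  k * k ^ k * (S + y) ^ suc k
    ≡⟨ *-assoc k (k ^ k) _ ⟩
  k * (k ^ k * (S + y) ^ suc k)
    ∎)
  where open ≤-Reasoning

amgm : ∀ xs → length xs ^ length xs * product xs ≤ sum xs ^ length xs
amgm []       = ≤-refl
amgm (y ∷ xs) = *-cancelˡ-≤ (k ^ k) {{n^n≢0 k}} (begin
  k ^ k * (suc k ^ suc k * (y * P))
    ≡⟨ solve 4 (λ A B y P → A :* (B :* (y :* P)) := B :* (A :* P :* y)) refl (k ^ k) (suc k ^ suc k) y P ⟩
  suc k ^ suc k * (k ^ k * P * y)
    ≤⟨ *-monoʳ-≤ (suc k ^ suc k) (*-monoˡ-≤ y (amgm xs)) ⟩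
  suc k ^ suc k * (S ^ k * y)
    ≤⟨ two-point-amgm k S y ⟩
  k ^ k * (S + y) ^ suc k
    ≡⟨ cong (λ z → k ^ k * z ^ suc k) (+-comm S y) ⟩
  k ^ k * (y + S) ^ suc k
    ∎)
  where
  open ≤-Reasoning
  k = length xs
  P = product xs
  S = sum xs

sum-∷ʳ : ∀ xs x → sum (xs ∷ʳ x) ≡ sum xs + x
sum-∷ʳ xs x = trans (sum-++ xs (x ∷ [])) (cong (λ t → sum xs + t) (+-identityʳ x))

product-∷ʳ : ∀ xs x → product (xs ∷ʳ x) ≡ product xs * x
product-∷ʳ xs x = trans (product-++ xs (x ∷ [])) (cong (product xs *_) (*-identityʳ x))

-- For r ≤ p, classSum p r as is the sum of the entries of as at positions
-- i ≡ r (mod p + 1).  Removing the head shifts every class index down by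
-- one, and class 0 of the tail continues as class p.
classSum : ℕ → ℕ → List ℕ → ℕ
classSum p r       []       = 0
classSum p zero    (a ∷ as) = a + classSum p p as
classSum p (suc r) (a ∷ as) = classSum p r as

-- The first k class sums; the full family is classSums p (suc p) as.
-- By the clauses above,
--   classSums p (suc k) (a ∷ as) = (a + classSum p p as) ∷ classSums p k as
-- holds definitionally.
classSums : ℕ → ℕ → List ℕ → List ℕ
classSums p k as = applyUpTo (λ r → classSum p r as) k

classSums-∷ʳ : ∀ p k as → classSums p (suc k) as ≡ classSums p k as ∷ʳ classSum p k as
classSums-∷ʳ p k as = sym (applyUpTo-∷ʳ (λ r → classSum p r as) k)

classSums-[] : ∀ p k → sum (classSums p k []) ≡ 0
classSums-[] p zero    = refl
classSums-[] p (suc k) = classSums-[] p k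

sum-classSums : ∀ p as → sum (classSums p (suc p) as) ≡ sum as
sum-classSums p []       = classSums-[] p (suc p)
sum-classSums p (a ∷ as) = begin
  a + c + sum (classSums p p as)     ≡⟨ solve 3 (λ a c s → a :+ c :+ s := a :+ (s :+ c)) refl a c (sum (classSums p p as)) ⟩
  a + (sum (classSums p p as) + c)   ≡⟨ cong (λ t → a + t) (sum-∷ʳ (classSums p p as) c) ⟨
  a + sum (classSums p p as ∷ʳ c)    ≡⟨ cong (λ cs → a + sum cs) (classSums-∷ʳ p p as) ⟨
  a + sum (classSums p (suc p) as)   ≡⟨ cong (λ t → a + t) (sum-classSums p as) ⟩
  a + sum as                         ∎
  where
  open ≡-Reasoning
  c = classSum p p as

-- The entry at position r is a summand of classSum p r, so the product of
-- the first j entries is bounded factorwise by that of the first j class sums.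
take-le-classSums : ∀ p j as → j ≤ length as → product (take j as) ≤ product (classSums p j as)
take-le-classSums p zero    as       _       = ≤-refl
take-le-classSums p (suc j) (b ∷ as) (s≤s j≤) =
  *-mono-≤ (m≤m+n b (classSum p p as)) (take-le-classSums p j as j≤)

windows : ℕ → ℕ → List ℕ → ℕ
windows p k as = sum (applyUpTo (λ j → product (take (suc p) (drop j as))) k)

-- Each window picks
-- one entry from every class, and distinct windows give distinct terms of
-- the expanded product; inductively, the first window is covered by the
-- terms containing the head a, the remaining ones by the terms containing
-- the last class sum of the tail.
windows-le : ∀ p k as → k + p ≤ length as → windows p k as ≤ product (classSums p (suc p) as)
windows-le p zero    as       _        = z≤n
windows-le p (suc k) (a ∷ as) (s≤s fit) = begin
  a * product (take p as) + windows p k as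
    ≤⟨ +-mono-≤ (*-monoʳ-≤ a (take-le-classSums p p as (≤-trans (m≤n+m p k) fit)))
                (windows-le p k as fit) ⟩
  a * P + product (classSums p (suc p) as)
    ≡⟨ cong (λ cs → a * P + product cs) (classSums-∷ʳ p p as) ⟩
  a * P + product (classSums p p as ∷ʳ c)
    ≡⟨ cong (λ t → a * P + t) (product-∷ʳ (classSums p p as) c) ⟩
  a * P + P * c
    ≡⟨ solve 3 (λ a P c → a :* P :+ P :* c := (a :+ c) :* P) refl a P c ⟩
  (a + c) * P
    ∎
  where
  open ≤-Reasoning
  c = classSum p p as
  P = product (classSums p p as)

windowSum-bound : ∀ p as → suc p ≤ length as → windowSum (suc p) as * suc p ^ suc p ≤ sum as ^ suc p
windowSum-bound p as m≤len = begin
  windowSum (suc p) as * m ^ m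
    ≡⟨ cong (λ ws → sum ws * m ^ m) (map-applyUpTo (λ j → j) window (suc (length as ∸ m))) ⟩
  windows p (suc (length as ∸ m)) as * m ^ m
    ≤⟨ *-monoˡ-≤ (m ^ m) (windows-le p (suc (length as ∸ m)) as windows-fit) ⟩
  product cs * m ^ m
    ≡⟨ *-comm (product cs) (m ^ m) ⟩
  m ^ m * product cs
    ≡⟨ cong (λ k → k ^ k * product cs) length-cs ⟨
  length cs ^ length cs * product cs
    ≤⟨ amgm cs ⟩
  sum cs ^ length cs
    ≡⟨ cong₂ _^_ (sum-classSums p as) length-cs ⟩
  sum as ^ m
    ∎
  where
  open ≤-Reasoning
  m = suc p
  window : ℕ → ℕ
  window j = product (take m (drop j as))
  cs = classSums p m as
  length-cs : length cs ≡ m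
  length-cs = length-applyUpTo (λ r → classSum p r as) m
  windows-fit : suc (length as ∸ m) + p ≤ length as
  windows-fit = ≤-reflexive (trans (sym (+-suc (length as ∸ m) p)) (m∸n+n≡m m≤len))

toℚᵘ-homo-^ : ∀ q k → toℚᵘ (q ^ℚ k) ≃ᵘ toℚᵘ q ^ᵘ k
toℚᵘ-homo-^ q zero    = ℚᵘ.≃-refl
toℚᵘ-homo-^ q (suc k) = ℚᵘ.≃-trans (ℚ.toℚᵘ-homo-* q (q ^ℚ k)) (ℚᵘ.*-congˡ {toℚᵘ q} (toℚᵘ-homo-^ q k))

↥-* : ∀ p q → ↥ (p *ᵘ q) ≡ ↥ p *ℤ ↥ q
↥-* (mkℚᵘ _ _) (mkℚᵘ _ _) = refl

↧-* : ∀ p q → ↧ₙ (p *ᵘ q) ≡ ↧ₙ p * ↧ₙ q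
↧-* (mkℚᵘ _ _) (mkℚᵘ _ _) = refl

↥-^ : ∀ n d k → ↥ (mkℚᵘ (+ n) d ^ᵘ k) ≡ + (n ^ k)
↥-^ n d zero    = refl
↥-^ n d (suc k) = begin
  ↥ (q *ᵘ q ^ᵘ k)     ≡⟨ ↥-* q (q ^ᵘ k) ⟩
  + n *ℤ ↥ (q ^ᵘ k)   ≡⟨ cong (λ z → + n *ℤ z) (↥-^ n d k) ⟩
  + n *ℤ + (n ^ k)    ≡⟨ ℤ.pos-* n (n ^ k) ⟨
  + (n * n ^ k)       ∎
  where
  open ≡-Reasoning
  q = mkℚᵘ (+ n) d

↧-^ : ∀ n d k → ↧ₙ (mkℚᵘ (+ n) d ^ᵘ k) ≡ suc d ^ k
↧-^ n d zero    = refl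
↧-^ n d (suc k) = trans (↧-* q (q ^ᵘ k)) (cong (suc d *_) (↧-^ n d k))
  where q = mkℚᵘ (+ n) d

ℕ-bound⇒ℚ-bound : ∀ W n d k → W * suc d ^ k ≤ n ^ k → (+ W / 1) ≤ℚ (+ n / suc d) ^ℚ k
ℕ-bound⇒ℚ-bound W n d k le =
  ℚ.toℚᵘ-cancel-≤ (ℚᵘ.≤-respˡ-≃ (ℚᵘ.≃-sym W≃) (ℚᵘ.≤-respʳ-≃ (ℚᵘ.≃-sym power≃) unnormalised))
  where
  W≃ : toℚᵘ (+ W / 1) ≃ᵘ mkℚᵘ (+ W) 0
  W≃ = ℚ.toℚᵘ-fromℚᵘ (mkℚᵘ (+ W) 0)
  power≃ : toℚᵘ ((+ n / suc d) ^ℚ k) ≃ᵘ mkℚᵘ (+ n) d ^ᵘ k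
  power≃ = ℚᵘ.≃-trans (toℚᵘ-homo-^ (+ n / suc d) k) (^ᵘ-congˡ k (ℚ.toℚᵘ-fromℚᵘ (mkℚᵘ (+ n) d)))
  cross-multiplied : + (W * suc d ^ k) ≤ℤ + (n ^ k * 1)
  cross-multiplied = +≤+ (subst (W * suc d ^ k ≤_) (sym (*-identityʳ (n ^ k))) le)
  unnormalised : mkℚᵘ (+ W) 0 ≤ᵘ mkℚᵘ (+ n) d ^ᵘ k
  unnormalised = *≤* (subst₂ _≤ℤ_
    (trans (ℤ.pos-* W _) (cong (λ z → + W *ℤ + z) (sym (↧-^ n d k))))
    (trans (ℤ.pos-* (n ^ k) 1) (cong (λ z → z *ℤ + 1) (sym (↥-^ n d k))))
    cross-multiplied)

lemma11 : (m n : ℕ) → (1≤m : 1 ≤ m) → m ≤ n → (as : List ℕ) → length as ≡ n → sum as ≡ n →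
          (+ windowSum m as / 1) ≤ℚ (_/_ (+ n) m {{>-nonZero 1≤m}}) ^ℚ m
lemma11 zero    n ()
lemma11 (suc p) n _ m≤n as refl sum≡n =
  ℕ-bound⇒ℚ-bound (windowSum m as) n p m
    (subst (λ s → windowSum m as * m ^ m ≤ s ^ m) sum≡n (windowSum-bound p as m≤n))
  where m = suc p
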